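{- There is a function $\varepsilon(m)$ with $\varepsilon(m)\to0$ as $m\to\infty$ such that for all positive integers $n,m$ and every $f\colon\mathbb{F}_2^n\to\mathbb{F}_2^m$: if $\log_2 m$ is an integer and $n+\log_2 m$ is even, then $c_\wedge(f)\le 2(1+\varepsilon(m))\sqrt{m2^n}$; otherwise $c_\wedge(f)\le 2.5(1+\varepsilon(m))\sqrt{m2^n}$.
   Context: $c_\wedge(f)$ denotes the multiplicative complexity of $f$: the minimum number of AND gates in an XOR-AND circuit (gates: unbounded fan-in XOR over $\mathbb{F}_2$, fan-in-2 AND, constant 1) computing all outputs of $f$. -}

module Defs where

open import Data.Bool using (Bool; true; false; _∧_; _xor_)
open import Data.Nat using (ℕ; zero; suc; _≤_; _^_) renaming (_*_ to _*ℕ_; _+_ to _+ℕ_)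
open import Data.Fin using (Fin)
open import Data.Vec using (Vec; []; _∷_; _∷ʳ_; lookup; map)
open import Data.Integer using (+_)
open import Data.Rational using (ℚ; 0ℚ; 1ℚ; _/_; _*_; _+_; _<_; ∣_∣) renaming (_≤_ to _≤ℚ_)
open import Data.Product using (Σ; _×_)
open import Relation.Binary.PropositionalEquality using (_≡_)

-- XOR-AND circuits as straight-line programs over 𝔽₂ = Bool.
data Gate (w : ℕ) : Set where
  xorG : Vec Bool w → Gate w
  andG : Fin w → Fin w → Gate w
  oneG : Gate w

xorSel : {w : ℕ} → Vec Bool w → Vec Bool w → Bool
xorSel []       []       = false
xorSel (s ∷ ss) (x ∷ xs) = (s ∧ x) xor xorSel ss xs

gateVal : {w : ℕ} → Gate w → Vec Bool w → Bool
gateVal (xorG s)   xs = xorSel s xs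
gateVal (andG i j) xs = lookup xs i ∧ lookup xs j
gateVal oneG       xs = true

isAnd : {w : ℕ} → Gate w → ℕ
isAnd (xorG _)   = 0
isAnd (andG _ _) = 1
isAnd oneG       = 0

data Prog (w : ℕ) : ℕ → Set where
  done : Prog w w
  step : {v : ℕ} → Gate w → Prog (suc w) v → Prog w v

evalProg : {w v : ℕ} → Prog w v → Vec Bool w → Vec Bool v
evalProg done       xs = xs
evalProg (step g p) xs = evalProg p (xs ∷ʳ gateVal g xs)

andCount : {w v : ℕ} → Prog w v → ℕ
andCount done       = 0
andCount (step g p) = isAnd g +ℕ andCount p

-- An XOR-AND circuit with n inputs and m outputs: the first n wires are
-- the inputs, outputs are designated wires.
record Circuit (n m : ℕ) : Set where
  field
    wires : ℕ
    prog  : Prog n wires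
    out   : Vec (Fin wires) m

open Circuit public

evalCircuit : {n m : ℕ} → Circuit n m → Vec Bool n → Vec Bool m
evalCircuit C x = map (lookup (evalProg (prog C) x)) (out C)

numAnd : {n m : ℕ} → Circuit n m → ℕ
numAnd C = andCount (prog C)

Computes : {n m : ℕ} → Circuit n m → (Vec Bool n → Vec Bool m) → Set
Computes C f = ∀ x → evalCircuit C x ≡ f x

-- c_∧(f) ≤ c : some circuit computing f uses at most c AND gates
-- (c_∧(f) is the minimum of numAnd over circuits computing f).
MCAtMost : {n m : ℕ} → (Vec Bool n → Vec Bool m) → ℕ → Set
MCAtMost f c = Σ (Circuit _ _) λ C → Computes C f × numAnd C ≤ c

ℕtoℚ : ℕ → ℚ
ℕtoℚ k = + k / 1

-- c ≤ a · √X  (c, X naturals, X > 0, a rational), expressed without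
-- square roots: since c ≥ 0 and √X > 0 this is equivalent to
-- 0 ≤ a ∧ c² ≤ a² X.
LeTimesSqrt : ℕ → ℚ → ℕ → Set
LeTimesSqrt c a X = (0ℚ ≤ℚ a) × (ℕtoℚ (c *ℕ c) ≤ℚ a * a * ℕtoℚ X)

TendsToZero : (ℕ → ℚ) → Set
TendsToZero ε = ∀ (δ : ℚ) → 0ℚ < δ → Σ ℕ λ M → ∀ m → M ≤ m → ∣ ε m ∣ < δ

Good : ℕ → ℕ → Set
Good n m = Σ ℕ λ k → (m ≡ 2 ^ k) × Σ ℕ λ j → n +ℕ k ≡ 2 *ℕ j

-- Both constructions rest on the minterm expansion h(v) = ⨁ₐ ([v = a] ∧ h(a)):
--   * full: all 2ⁿ minterms of the input; every output is then an XOR of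
--     minterms, which is free, so c∧(f) ≤ 2ⁿ;
--   * split: for x = y ++ z with |y| = k, |z| = r, compute the minterms of y and
--     of z and use fᵢ(y ++ z) = ⨁_b ([z = b] ∧ fᵢ(y ++ b)); c∧(f) ≤ 2ᵏ + 2ʳ + m·2ʳ.  Taking
-- 2ᵏ = m·2ʳ exactly (good case), within a factor 2 (general case), or the full
-- construction when 2ⁿ is small compared with m gives the two bounds, which are
-- finally transferred to the rational coefficients of the statement.

module Submission where

open import Defs
open import Data.Bool using (Bool; true; false; not; _∧_; _xor_)
open import Data.Bool.Properties
  using (∧-identityʳ; ∧-zeroʳ; xor-identityʳ; xor-same; ∧-distribʳ-xor; xor-∧-commutativeRing)
open import Data.Nat using (ℕ; zero; suc; _+_; _*_; _∸_; _^_; _≤_; _<_; z≤n; s≤s; _≤?_)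
open import Data.Nat.Properties
open import Data.Nat.Tactic.RingSolver using (solve-∀)
open import Data.Fin using (Fin; zero; suc; inject₁; fromℕ; _↑ˡ_; _↑ʳ_)
open import Data.Vec
  using (Vec; []; _∷_; _∷ʳ_; head; tail; lookup; map; tabulate; replicate; zipWith; take; drop; _++_)
open import Data.Vec.Properties using (tabulate-∘; tabulate-cong; tabulate∘lookup; lookup-++ˡ; lookup-++ʳ; take++drop≡id)
open import Data.Integer using (+_)
open import Data.Rational using (ℚ; 0ℚ; 1ℚ; _/_; mkℚ; toℚᵘ; ∣_∣) renaming (_*_ to _*ℚ_; _+_ to _+ℚ_)
import Data.Integer as ℤ
import Data.Rational as ℚ
import Data.Integer.Properties as ℤₚ
import Data.Rational.Properties as ℚₚ
import Data.Rational.Unnormalised as ℚᵘ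
import Data.Rational.Unnormalised.Properties as ℚᵘₚ
open ℚᵘ using (ℚᵘ; mkℚᵘ; *≡*; *≤*; *<*; _≃_)
open import Data.Product using (Σ; _×_; _,_; proj₁; proj₂)
open import Function using (id; _∘_)
open import Relation.Nullary using (¬_; yes; no; contradiction)
open import Relation.Binary.PropositionalEquality
open import Algebra.Bundles using (CommutativeRing)
open import Algebra.Properties.CommutativeSemigroup
  (CommutativeRing.+-commutativeSemigroup xor-∧-commutativeRing) using (interchange)

variable
  n : ℕ

Fn : ℕ → Set
Fn n = Vec Bool n → Bool

record Partial (n : ℕ) : Set where
  constructor partial
  field
    width   : ℕ
    program : Prog n width
open Partial

cost : Partial n → ℕ
cost s = andCount (program s)

record _⊢_ (s : Partial n) (g : Fn n) : Set where
  constructor wire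
  field
    index   : Fin (width s)
    correct : ∀ x → lookup (evalProg (program s) x) index ≡ g x

⊢-cong : {s : Partial n} {g h : Fn n} → s ⊢ g → g ≗ h → s ⊢ h
⊢-cong (wire i ok) g≗h = wire i (λ x → trans (ok x) (g≗h x))

_⊑_ : Partial n → Partial n → Set
s ⊑ s' = ∀ {g} → s ⊢ g → s' ⊢ g

⊑-refl : {s : Partial n} → s ⊑ s
⊑-refl h = h

⊑-trans : {s₁ s₂ s₃ : Partial n} → s₁ ⊑ s₂ → s₂ ⊑ s₃ → s₁ ⊑ s₃
⊑-trans s₁⊑s₂ s₂⊑s₃ h = s₂⊑s₃ (s₁⊑s₂ h)

Monotone : (Partial n → Set) → Set
Monotone P = ∀ {s s'} → s ⊑ s' → P s → P s'

record Extension (s : Partial n) (c : ℕ) (P : Partial n → Set) : Set where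
  constructor extend
  field
    result   : Partial n
    extends  : s ⊑ result
    bounded  : cost result ≤ c + cost s
    property : P result

pure : {s : Partial n} {P : Partial n → Set} → P s → Extension s 0 P
pure {s = s} p = extend s ⊑-refl ≤-refl p

_>>=_ : {s : Partial n} {c d : ℕ} {P Q : Partial n → Set} → Extension s c P →
  (∀ s₁ → s ⊑ s₁ → P s₁ → Extension s₁ d Q) → Extension s (c + d) Q
_>>=_ {s = s} {c} {d} (extend s₁ s⊑s₁ bound₁ p) k with k s₁ s⊑s₁ p
... | extend s₂ s₁⊑s₂ bound₂ q = extend s₂ (⊑-trans s⊑s₁ s₁⊑s₂) bound q
  where
  bound : cost s₂ ≤ (c + d) + cost s
  bound = begin
    cost s₂            ≤⟨ bound₂ ⟩
    d + cost s₁        ≤⟨ +-monoʳ-≤ d bound₁ ⟩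
    d + (c + cost s)   ≡⟨ sym (+-assoc d c (cost s)) ⟩
    (d + c) + cost s   ≡⟨ cong (_+ cost s) (+-comm d c) ⟩
    (c + d) + cost s   ∎
    where open ≤-Reasoning

mapExt : {s : Partial n} {c : ℕ} {P Q : Partial n → Set} → Extension s c P →
  (∀ {s'} → s ⊑ s' → P s' → Q s') → Extension s c Q
mapExt (extend s' s⊑s' bound p) f = extend s' s⊑s' bound (f s⊑s' p)

relax : {s : Partial n} {c d : ℕ} {P : Partial n → Set} → c ≤ d → Extension s c P → Extension s d P
relax c≤d (extend s' s⊑s' bound p) = extend s' s⊑s' (≤-trans bound (+-monoˡ-≤ _ c≤d)) p

snoc : {a b : ℕ} → Prog a b → Gate b → Prog a (suc b)
snoc done       g = step g done
snoc (step h p) g = step h (snoc p g)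

eval-snoc : {a b : ℕ} (p : Prog a b) (g : Gate b) (x : Vec Bool a) →
  evalProg (snoc p g) x ≡ evalProg p x ∷ʳ gateVal g (evalProg p x)
eval-snoc done       g x = refl
eval-snoc (step h p) g x = eval-snoc p g (x ∷ʳ gateVal h x)

andCount-snoc : {a b : ℕ} (p : Prog a b) (g : Gate b) → andCount (snoc p g) ≡ andCount p + isAnd g
andCount-snoc done       g = +-identityʳ (isAnd g)
andCount-snoc (step h p) g = trans (cong (λ k → isAnd h + k) (andCount-snoc p g)) (sym (+-assoc (isAnd h) _ _))

lookup-∷ʳ-old : {w : ℕ} (xs : Vec Bool w) (y : Bool) (i : Fin w) → lookup (xs ∷ʳ y) (inject₁ i) ≡ lookup xs i
lookup-∷ʳ-old (x ∷ xs) y zero    = refl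
lookup-∷ʳ-old (x ∷ xs) y (suc i) = lookup-∷ʳ-old xs y i

lookup-∷ʳ-new : {w : ℕ} (xs : Vec Bool w) (y : Bool) → lookup (xs ∷ʳ y) (fromℕ w) ≡ y
lookup-∷ʳ-new []       y = refl
lookup-∷ʳ-new (x ∷ xs) y = lookup-∷ʳ-new xs y

addGate : (s : Partial n) (g : Gate (width s)) →
  Extension s (isAnd g) (_⊢ λ x → gateVal g (evalProg (program s) x))
addGate (partial w p) g = extend (partial (suc w) (snoc p g)) keepsOld bound newWire
  where
  keepsOld : partial w p ⊑ partial (suc w) (snoc p g)
  keepsOld (wire i ok) = wire (inject₁ i) λ x →
    trans (cong (λ v → lookup v (inject₁ i)) (eval-snoc p g x)) (trans (lookup-∷ʳ-old (evalProg p x) _ i) (ok x))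
  bound : andCount (snoc p g) ≤ isAnd g + andCount p
  bound = ≤-reflexive (trans (andCount-snoc p g) (+-comm (andCount p) (isAnd g)))
  newWire : partial (suc w) (snoc p g) ⊢ λ x → gateVal g (evalProg p x)
  newWire = wire (fromℕ w) λ x →
    trans (cong (λ v → lookup v (fromℕ w)) (eval-snoc p g x)) (lookup-∷ʳ-new (evalProg p x) _)

oneHot : {w : ℕ} → Fin w → Vec Bool w
oneHot zero    = true ∷ replicate _ false
oneHot (suc i) = false ∷ oneHot i

xorSel-none : {w : ℕ} (xs : Vec Bool w) → xorSel (replicate w false) xs ≡ false
xorSel-none []       = refl
xorSel-none (x ∷ xs) = xorSel-none xs

xorSel-oneHot : {w : ℕ} (i : Fin w) (xs : Vec Bool w) → xorSel (oneHot i) xs ≡ lookup xs i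
xorSel-oneHot zero    (x ∷ xs) = trans (cong (x xor_) (xorSel-none xs)) (xor-identityʳ x)
xorSel-oneHot (suc i) (x ∷ xs) = xorSel-oneHot i xs

xorSel-linear : {w : ℕ} (s t xs : Vec Bool w) → xorSel (zipWith _xor_ s t) xs ≡ xorSel s xs xor xorSel t xs
xorSel-linear []       []       []       = refl
xorSel-linear (s ∷ ss) (t ∷ ts) (x ∷ xs) =
  trans (cong₂ _xor_ (∧-distribʳ-xor x s t) (xorSel-linear ss ts xs))
        (interchange (s ∧ x) (t ∧ x) (xorSel ss xs) (xorSel ts xs))

andWire : {s : Partial n} {g h : Fn n} → s ⊢ g → s ⊢ h → Extension s 1 (_⊢ λ x → g x ∧ h x)
andWire {s = s} (wire i gi) (wire j hj) =
  mapExt (addGate s (andG i j)) λ _ new → ⊢-cong new λ x → cong₂ _∧_ (gi x) (hj x)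

xorWire : {s : Partial n} {g h : Fn n} → s ⊢ g → s ⊢ h → Extension s 0 (_⊢ λ x → g x xor h x)
xorWire {s = s} (wire i gi) (wire j hj) =
  mapExt (addGate s (xorG (zipWith _xor_ (oneHot i) (oneHot j)))) λ _ new → ⊢-cong new λ x →
    trans (xorSel-linear (oneHot i) (oneHot j) _)
          (cong₂ _xor_ (trans (xorSel-oneHot i _) (gi x)) (trans (xorSel-oneHot j _) (hj x)))

oneWire : (s : Partial n) → Extension s 0 (_⊢ λ _ → true)
oneWire s = addGate s oneG

zeroWire : (s : Partial n) → Extension s 0 (_⊢ λ _ → false)
zeroWire s = mapExt (addGate s (xorG (replicate _ false))) λ _ new →
  ⊢-cong new λ x → xorSel-none (evalProg (program s) x)

⨁ : (j : ℕ) → (Vec Bool j → Bool) → Bool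
⨁ zero    F = F []
⨁ (suc j) F = ⨁ j (λ a → F (true ∷ a)) xor ⨁ j (λ a → F (false ∷ a))

⨁-cong : (j : ℕ) {F G : Vec Bool j → Bool} → F ≗ G → ⨁ j F ≡ ⨁ j G
⨁-cong zero    F≗G = F≗G []
⨁-cong (suc j) F≗G = cong₂ _xor_ (⨁-cong j (F≗G ∘ (true ∷_))) (⨁-cong j (F≗G ∘ (false ∷_)))

⨁-false : (j : ℕ) → ⨁ j (λ _ → false) ≡ false
⨁-false zero    = refl
⨁-false (suc j) = cong₂ _xor_ (⨁-false j) (⨁-false j)

minterm : {j : ℕ} → Vec Bool j → Vec Bool j → Bool
minterm []          v = true
minterm (true ∷ a)  v = head v ∧ minterm a (tail v)
minterm (false ∷ a) v = not (head v) ∧ minterm a (tail v)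

expansion : (j : ℕ) (h : Vec Bool j → Bool) (v : Vec Bool j) → ⨁ j (λ a → minterm a v ∧ h a) ≡ h v
expansion zero    h [] = refl
expansion (suc j) h (true ∷ v) = begin
  ⨁ j (λ a → minterm a v ∧ h (true ∷ a)) xor ⨁ j (λ _ → false)
    ≡⟨ cong₂ _xor_ (expansion j (h ∘ (true ∷_)) v) (⨁-false j) ⟩
  h (true ∷ v) xor false
    ≡⟨ xor-identityʳ _ ⟩
  h (true ∷ v) ∎
  where open ≡-Reasoning
expansion (suc j) h (false ∷ v) = cong₂ _xor_ (⨁-false j) (expansion j (h ∘ (false ∷_)) v)

forEachVector : (j : ℕ) (Q : Vec Bool j → Partial n → Set) → (∀ a → Monotone (Q a)) →
  {d : ℕ} (s : Partial n) → (∀ a s₁ → s ⊑ s₁ → Extension s₁ d (Q a)) →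
  Extension s (2 ^ j * d) (λ s' → ∀ a → Q a s')
forEachVector zero Q mono {d} s stepAt =
  relax (≤-reflexive (sym (+-identityʳ d))) (mapExt (stepAt [] s ⊑-refl) λ _ q → λ { [] → q })
forEachVector (suc j) Q mono {d} s stepAt =
  relax (≤-reflexive (twice (2 ^ j) d))
    (forEachVector j (Q ∘ (true ∷_)) (mono ∘ (true ∷_)) s (stepAt ∘ (true ∷_)) >>= λ s₁ s⊑s₁ qsTrue →
     mapExt (forEachVector j (Q ∘ (false ∷_)) (mono ∘ (false ∷_)) s₁
               (λ a s₂ s₁⊑s₂ → stepAt (false ∷ a) s₂ (⊑-trans s⊑s₁ s₁⊑s₂)))
       λ s₁⊑s' qsFalse → λ { (true ∷ a) → mono (true ∷ a) s₁⊑s' (qsTrue a) ; (false ∷ a) → qsFalse a })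
  where
  twice : (x d : ℕ) → x * d + x * d ≡ (2 * x) * d
  twice = solve-∀

forEachOutput : (m : ℕ) (Q : Fin m → Partial n → Set) → (∀ i → Monotone (Q i)) →
  {d : ℕ} (s : Partial n) → (∀ i s₁ → s ⊑ s₁ → Extension s₁ d (Q i)) →
  Extension s (m * d) (λ s' → ∀ i → Q i s')
forEachOutput zero    Q mono s stepAt = pure λ ()
forEachOutput (suc m) Q mono s stepAt =
  stepAt zero s ⊑-refl >>= λ s₁ s⊑s₁ qZero →
  mapExt (forEachOutput m (Q ∘ suc) (mono ∘ suc) s₁ (λ i s₂ s₁⊑s₂ → stepAt (suc i) s₂ (⊑-trans s⊑s₁ s₁⊑s₂)))
    λ s₁⊑s' qsSuc → λ { zero → mono zero s₁⊑s' qZero ; (suc i) → qsSuc i }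

⊢-mono : (g : Fn n) → Monotone (_⊢ g)
⊢-mono g s⊑s' h = s⊑s' h

combination : (j : ℕ) (c : Vec Bool j → Bool) (F : Vec Bool j → Fn n) (s : Partial n) →
  (∀ a → s ⊢ F a) → Extension s 0 (_⊢ λ x → ⨁ j λ a → F a x ∧ c a)
combination zero c F s available with c []
... | true  = pure (⊢-cong (available []) λ x → sym (∧-identityʳ _))
... | false = mapExt (zeroWire s) λ _ h → ⊢-cong h λ x → sym (∧-zeroʳ _)
combination (suc j) c F s available =
  combination j (c ∘ (true ∷_)) (F ∘ (true ∷_)) s (available ∘ (true ∷_)) >>= λ s₁ s⊑s₁ hTrue →
  combination j (c ∘ (false ∷_)) (F ∘ (false ∷_)) s₁ (λ a → s⊑s₁ (available (false ∷ a))) >>= λ s₂ s₁⊑s₂ hFalse →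
  xorWire (s₁⊑s₂ hTrue) hFalse

Coordinates : {j : ℕ} → (Vec Bool n → Vec Bool j) → Partial n → Set
Coordinates π s = ∀ i → s ⊢ λ x → lookup (π x) i

Minterms : {j : ℕ} → (Vec Bool n → Vec Bool j) → Partial n → Set
Minterms π s = ∀ a → s ⊢ λ x → minterm a (π x)

lookup-head : {j : ℕ} (v : Vec Bool (suc j)) → lookup v zero ≡ head v
lookup-head (b ∷ v) = refl

lookup-tail : {j : ℕ} (v : Vec Bool (suc j)) (i : Fin j) → lookup v (suc i) ≡ lookup (tail v) i
lookup-tail (b ∷ v) i = refl

-- The minterm with a negated literal is obtained from the shorter one by one XOR.
negated-literal : (b y : Bool) → y xor (b ∧ y) ≡ not b ∧ y
negated-literal true  y = xor-same y
negated-literal false y = xor-identityʳ y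

-- All 2^j minterms of j available functions cost at most 2^j AND gates:
-- from the minterms m_a of the last j - 1 coordinates, x₀ ∧ m_a costs one AND
-- and ¬x₀ ∧ m_a = m_a ⊕ (x₀ ∧ m_a) is free.
minterms : (j : ℕ) (π : Vec Bool n → Vec Bool j) (s : Partial n) →
  Coordinates π s → Extension s (2 ^ j) (Minterms π)
minterms zero π s _ = relax z≤n (mapExt (oneWire s) λ _ one → λ { [] → one })
minterms (suc j) π s coords =
  relax (≤-reflexive (double (2 ^ j)))
    (minterms j (tail ∘ π) s (λ i → ⊢-cong (coords (suc i)) λ x → lookup-tail (π x) i) >>= λ s₁ s⊑s₁ shorter →
     mapExt (forEachVector j Extended (λ a s⊑s' (hT , hF) → s⊑s' hT , s⊑s' hF) s₁
               λ a s₂ s₁⊑s₂ → extendBy a (⊑-trans s⊑s₁ s₁⊑s₂) (s₁⊑s₂ (shorter a)))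
       λ _ both → λ { (true ∷ a) → proj₁ (both a) ; (false ∷ a) → proj₂ (both a) })
  where
  double : (x : ℕ) → x + x * 1 ≡ 2 * x
  double = solve-∀
  Extended : Vec Bool j → Partial _ → Set
  Extended a s' = (s' ⊢ λ x → minterm (true ∷ a) (π x)) × (s' ⊢ λ x → minterm (false ∷ a) (π x))
  extendBy : (a : Vec Bool j) {s₂ : Partial _} → s ⊑ s₂ → (s₂ ⊢ λ x → minterm a (tail (π x))) →
    Extension s₂ 1 (Extended a)
  extendBy a s⊑s₂ short =
    andWire (⊢-cong (s⊑s₂ (coords zero)) λ x → lookup-head (π x)) short >>= λ s₃ s₂⊑s₃ positive →
    mapExt (xorWire (s₂⊑s₃ short) positive) λ s₃⊑s' negative →
      s₃⊑s' positive , ⊢-cong negative λ x → negated-literal (head (π x)) _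

throughMinterms : {j : ℕ} (π : Vec Bool n → Vec Bool j) (h : Vec Bool j → Bool) (s : Partial n) →
  Minterms π s → Extension s 0 (_⊢ λ x → h (π x))
throughMinterms {j = j} π h s available =
  mapExt (combination j h (λ a x → minterm a (π x)) s available) λ _ w → ⊢-cong w λ x → expansion j h (π x)

initial : (n : ℕ) → Partial n
initial n = partial n done

inputs : Coordinates id (initial n)
inputs i = wire i λ _ → refl

Outputs : {m : ℕ} → (Vec Bool n → Vec Bool m) → Partial n → Set
Outputs f s = ∀ i → s ⊢ λ x → lookup (f x) i

toCircuit : {m c : ℕ} (f : Vec Bool n → Vec Bool m) → Extension (initial n) c (Outputs f) → MCAtMost f c
toCircuit {n} {m} {c} f (extend (partial w p) _ bound outputs) =
  C , computes , ≤-trans bound (≤-reflexive (+-identityʳ c))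
  where
  C : Circuit n m
  C = record { wires = w ; prog = p ; out = tabulate λ i → _⊢_.index (outputs i) }
  computes : Computes C f
  computes x = begin
    map (lookup (evalProg p x)) (tabulate λ i → _⊢_.index (outputs i))
      ≡⟨ tabulate-∘ _ _ ⟨
    tabulate (λ i → lookup (evalProg p x) (_⊢_.index (outputs i)))
      ≡⟨ tabulate-cong (λ i → _⊢_.correct (outputs i) x) ⟩
    tabulate (lookup (f x))
      ≡⟨ tabulate∘lookup (f x) ⟩
    f x ∎
    where open ≡-Reasoning

-- c∧(f) ≤ 2^n: compute all minterms of the input; then every output is free.
fullConstruction : {m : ℕ} (f : Vec Bool n → Vec Bool m) → MCAtMost f (2 ^ n)
fullConstruction {n} {m} f = toCircuit f (relax (≤-reflexive cost≡)
  (minterms n id (initial n) inputs >>= λ s₁ _ available →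
   forEachOutput m (λ i → _⊢ λ x → lookup (f x) i) (λ i → ⊢-mono _) s₁ λ i s₂ s₁⊑s₂ →
     throughMinterms id (λ v → lookup (f v) i) s₂ (s₁⊑s₂ ∘ available)))
  where
  cost≡ : 2 ^ n + m * 0 ≡ 2 ^ n
  cost≡ = trans (cong (λ k → 2 ^ n + k) (*-zeroʳ m)) (+-identityʳ _)

lookup-take : (k : ℕ) {r : ℕ} (x : Vec Bool (k + r)) (i : Fin k) → lookup (take k x) i ≡ lookup x (i ↑ˡ r)
lookup-take k {r} x i =
  trans (sym (lookup-++ˡ (take k x) (drop k x) i)) (cong (λ v → lookup v (i ↑ˡ r)) (take++drop≡id k x))

lookup-drop : (k : ℕ) {r : ℕ} (x : Vec Bool (k + r)) (i : Fin r) → lookup (drop k x) i ≡ lookup x (k ↑ʳ i)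
lookup-drop k x i =
  trans (sym (lookup-++ʳ (take k x) (drop k x) i)) (cong (λ v → lookup v (k ↑ʳ i)) (take++drop≡id k x))

-- Writing x = y ++ z with y the first k and z the last r inputs,
--   fᵢ(y ++ z) = ⨁_b (m_b(z) ∧ fᵢ(y ++ b)),
-- all minterms of y and of z cost 2^k + 2^r, each fᵢ(· ++ b) is free from the
-- minterms of y, so each output costs 2^r further AND gates.
splitConstruction : {m : ℕ} (k r : ℕ) → k + r ≡ n → (f : Vec Bool n → Vec Bool m) →
  MCAtMost f (2 ^ k + 2 ^ r + m * 2 ^ r)
splitConstruction {m = m} k r refl f =
  toCircuit f (relax (≤-reflexive (sym (+-assoc (2 ^ k) (2 ^ r) (m * 2 ^ r))))
    (minterms k (take k) (initial (k + r)) firstInputs >>= λ s₁ s₀⊑s₁ mintermsY →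
     minterms r (drop k) s₁ (s₀⊑s₁ ∘ lastInputs) >>= λ s₂ s₁⊑s₂ mintermsZ →
     forEachOutput m (λ i → _⊢ λ x → lookup (f x) i) (λ i → ⊢-mono _) s₂ λ i s₃ s₂⊑s₃ →
       output i s₃ (⊑-trans s₁⊑s₂ s₂⊑s₃ ∘ mintermsY) (s₂⊑s₃ ∘ mintermsZ)))
  where
  firstInputs : Coordinates (take k) (initial (k + r))
  firstInputs i = ⊢-cong (inputs (i ↑ˡ r)) λ x → sym (lookup-take k x i)
  lastInputs : Coordinates (drop k) (initial (k + r))
  lastInputs i = ⊢-cong (inputs (k ↑ʳ i)) λ x → sym (lookup-drop k x i)
  fᵢ : Fin m → Vec Bool k → Vec Bool r → Bool
  fᵢ i y z = lookup (f (y ++ z)) i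
  Term : Fin m → Vec Bool r → Fn (k + r)
  Term i b x = minterm b (drop k x) ∧ fᵢ i (take k x) b
  reassemble : (i : Fin m) (x : Vec Bool (k + r)) → ⨁ r (λ b → Term i b x ∧ true) ≡ lookup (f x) i
  reassemble i x = begin
    ⨁ r (λ b → Term i b x ∧ true)            ≡⟨ ⨁-cong r (λ b → ∧-identityʳ _) ⟩
    ⨁ r (λ b → Term i b x)                   ≡⟨ expansion r (fᵢ i (take k x)) (drop k x) ⟩
    lookup (f (take k x ++ drop k x)) i      ≡⟨ cong (λ v → lookup (f v) i) (take++drop≡id k x) ⟩
    lookup (f x) i                           ∎
    where open ≡-Reasoning
  output : (i : Fin m) (s : Partial (k + r)) → Minterms (take k) s → Minterms (drop k) s →
    Extension s (2 ^ r) (_⊢ λ x → lookup (f x) i)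
  output i s mintermsY mintermsZ = relax (≤-reflexive cost≡)
    (forEachVector r (λ b → _⊢ Term i b) (λ b → ⊢-mono _) s (λ b s₁ s⊑s₁ →
       throughMinterms (take k) (λ y → fᵢ i y b) s₁ (s⊑s₁ ∘ mintermsY) >>= λ s₂ s₁⊑s₂ value →
       andWire (s₁⊑s₂ (s⊑s₁ (mintermsZ b))) value) >>= λ s₁ _ terms →
     mapExt (combination r (λ _ → true) (Term i) s₁ terms) λ _ sum → ⊢-cong sum (reassemble i))
    where
    cost≡ : 2 ^ r * 1 + 0 ≡ 2 ^ r
    cost≡ = trans (+-identityʳ _) (*-identityʳ _)

infix 4 _≤_·√_
record _≤_·√_ (c α X : ℕ) : Set where
  constructor squared
  field
    squared-≤ : c * c ≤ α * α * X

·√-resp : {c c' α α' X X' : ℕ} → c ≡ c' → α ≡ α' → X ≡ X' → c ≤ α ·√ X → c' ≤ α' ·√ X'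
·√-resp refl refl refl bound = bound

·√-exact : (α y : ℕ) → α * y ≤ α ·√ (y * y)
·√-exact α y = squared (≤-reflexive (rearrange α y))
  where
  rearrange : (α y : ℕ) → α * y * (α * y) ≡ α * α * (y * y)
  rearrange = solve-∀

·√-scale : (d : ℕ) {c α X : ℕ} → c ≤ α ·√ X → d * c ≤ (d * α) ·√ X
·√-scale d {c} {α} {X} (squared c²≤) = squared (begin
  d * c * (d * c)        ≡⟨ rearrange d c ⟩
  d * d * (c * c)        ≤⟨ *-monoʳ-≤ (d * d) c²≤ ⟩
  d * d * (α * α * X)    ≡⟨ rearrange' d α X ⟩
  d * α * (d * α) * X    ∎)
  where
  open ≤-Reasoning
  rearrange : (d c : ℕ) → d * c * (d * c) ≡ d * d * (c * c)
  rearrange = solve-∀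
  rearrange' : (d α X : ℕ) → d * d * (α * α * X) ≡ d * α * (d * α) * X
  rearrange' = solve-∀

square-cancel : {a b : ℕ} → a * a ≤ b * b → a ≤ b
square-cancel {a} {b} a²≤b² with a ≤? b
... | yes a≤b = a≤b
... | no a≰b = contradiction a²≤b² (<⇒≱ (*-mono-< (≰⇒> a≰b) (≰⇒> a≰b)))

-- Bounds by multiples of the same square root add up; the cross term is
-- controlled because (ab)² ≤ (αβX)².
·√-add : {a b α β X : ℕ} → a ≤ α ·√ X → b ≤ β ·√ X → a + b ≤ (α + β) ·√ X
·√-add {a} {b} {α} {β} {X} (squared a²≤) (squared b²≤) = squared (begin
  (a + b) * (a + b)                          ≡⟨ expand a b ⟩
  a * a + 2 * (a * b) + b * b                ≤⟨ +-mono-≤ (+-mono-≤ a²≤ (*-monoʳ-≤ 2 cross)) b²≤ ⟩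
  α * α * X + 2 * (α * β * X) + β * β * X    ≡⟨ collect α β X ⟩
  (α + β) * (α + β) * X                      ∎)
  where
  open ≤-Reasoning
  expand : (a b : ℕ) → (a + b) * (a + b) ≡ a * a + 2 * (a * b) + b * b
  expand = solve-∀
  collect : (α β X : ℕ) → α * α * X + 2 * (α * β * X) + β * β * X ≡ (α + β) * (α + β) * X
  collect = solve-∀
  product-of-squares : (x y : ℕ) → x * x * (y * y) ≡ x * y * (x * y)
  product-of-squares = solve-∀
  product-of-bounds : (x y z : ℕ) → x * x * z * (y * y * z) ≡ x * y * z * (x * y * z)
  product-of-bounds = solve-∀
  cross : a * b ≤ α * β * X
  cross = square-cancel (subst₂ _≤_ (product-of-squares a b) (product-of-bounds α β X) (*-mono-≤ a²≤ b²≤))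

fullBound : (p q m B κ : ℕ) → B ≤ κ * m → κ * (suc q * suc q) ≤ p * p →
  B * (suc q * (2 * m)) ≤ p * (2 * m + 1) ·√ (m * B)
fullBound p q m B κ B≤κm κq²≤p² = squared (begin
  B * D * (B * D)    ≡⟨ regroup B D ⟩
  B * (B * (D * D))  ≤⟨ *-monoʳ-≤ B perUnit ⟩
  B * (N * N * m)    ≡⟨ regroup' B N m ⟩
  N * N * (m * B)    ∎)
  where
  open ≤-Reasoning
  D = suc q * (2 * m)
  N = p * (2 * m + 1)
  regroup : (B D : ℕ) → B * D * (B * D) ≡ B * (B * (D * D))
  regroup = solve-∀
  regroup' : (B N m : ℕ) → B * (N * N * m) ≡ N * N * (m * B)
  regroup' = solve-∀
  separate : (κ m q : ℕ) → κ * m * (suc q * (2 * m) * (suc q * (2 * m)))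
                         ≡ m * (κ * (suc q * suc q) * (2 * m * (2 * m)))
  separate = solve-∀
  regroup'' : (p m : ℕ) → m * (p * p * ((2 * m + 1) * (2 * m + 1))) ≡ p * (2 * m + 1) * (p * (2 * m + 1)) * m
  regroup'' = solve-∀
  2m≤2m+1 : 2 * m ≤ 2 * m + 1
  2m≤2m+1 = m≤m+n (2 * m) 1
  perUnit : B * (D * D) ≤ N * N * m
  perUnit = begin
    B * (D * D)                                         ≤⟨ *-monoˡ-≤ (D * D) B≤κm ⟩
    κ * m * (D * D)                                     ≡⟨ separate κ m q ⟩
    m * (κ * (suc q * suc q) * (2 * m * (2 * m)))       ≤⟨ *-monoʳ-≤ m (*-mono-≤ κq²≤p² (*-mono-≤ 2m≤2m+1 2m≤2m+1)) ⟩
    m * (p * p * ((2 * m + 1) * (2 * m + 1)))           ≡⟨ regroup'' p m ⟩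
    N * N * m                                           ∎

-- Indeed c·2mD = 2(m−1)·D(A+u) + 2D(A+2u)
-- and p(2m+1) = 2(m−1)·p + 3p.
splitBound : (p q m' A R : ℕ) →
  suc q * (A + suc m' * R) ≤ p ·√ (A * (suc m' * R)) →
  2 * suc q * (A + 2 * (suc m' * R)) ≤ 3 * p ·√ (A * (suc m' * R)) →
  (A + R + suc m' * R) * (suc q * (2 * suc m')) ≤ p * (2 * suc m' + 1) ·√ (suc m' * (A * R))
splitBound p q m' A R bound₁ bound₂ =
  ·√-resp (cost≡ q m' A R) (coefficient≡ p m') (radicand≡ m' A R)
    (·√-add (·√-scale (2 * m') bound₁) bound₂)
  where
  cost≡ : (q m' A R : ℕ) → 2 * m' * (suc q * (A + suc m' * R)) + 2 * suc q * (A + 2 * (suc m' * R))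
                         ≡ (A + R + suc m' * R) * (suc q * (2 * suc m'))
  cost≡ = solve-∀
  coefficient≡ : (p m' : ℕ) → 2 * m' * p + 3 * p ≡ p * (2 * suc m' + 1)
  coefficient≡ = solve-∀
  radicand≡ : (m' A R : ℕ) → A * (suc m' * R) ≡ suc m' * (A * R)
  radicand≡ = solve-∀

-- When m·R = A the split meets the bound 2(1 + 1/2m)√(m·2^n) exactly.
exactSplitBound : (m' A R : ℕ) → suc m' * R ≡ A →
  (A + R + suc m' * R) * (1 * (2 * suc m')) ≤ 2 * (2 * suc m' + 1) ·√ (suc m' * (A * R))
exactSplitBound m' A R u≡A = splitBound 2 0 m' A R bound₁ bound₂
  where
  twice : (A : ℕ) → 2 * A ≡ 1 * (A + A)
  twice = solve-∀
  sixfold : (A : ℕ) → 6 * A ≡ 2 * 1 * (A + 2 * A)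
  sixfold = solve-∀
  bound₁ : 1 * (A + suc m' * R) ≤ 2 ·√ (A * (suc m' * R))
  bound₁ rewrite u≡A = ·√-resp (twice A) refl refl (·√-exact 2 A)
  bound₂ : 2 * 1 * (A + 2 * (suc m' * R)) ≤ 3 * 2 ·√ (A * (suc m' * R))
  bound₂ rewrite u≡A = ·√-resp (sixfold A) refl refl (·√-exact 6 A)

thirds : {A u : ℕ} → u ≤ 2 * A → A ≤ 2 * u →
  Σ ℕ λ s → Σ ℕ λ t → (3 * A ≡ 2 * s + t) × (3 * u ≡ s + 2 * t)
thirds {A} {u} u≤2A A≤2u =
  s , t , +-cancelʳ-≡ (2 * u + A) _ _ forA , +-cancelʳ-≡ (2 * A + u) _ _ forU
  where
  s = 2 * A ∸ u
  t = 2 * u ∸ A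
  s+u : s + u ≡ 2 * A
  s+u = m∸n+n≡m u≤2A
  t+A : t + A ≡ 2 * u
  t+A = m∸n+n≡m A≤2u
  regroupA : (s t u A : ℕ) → (2 * s + t) + (2 * u + A) ≡ 2 * (s + u) + (t + A)
  regroupA = solve-∀
  regroupU : (s t u A : ℕ) → (s + 2 * t) + (2 * A + u) ≡ (s + u) + 2 * (t + A)
  regroupU = solve-∀
  expandA : (A u : ℕ) → 3 * A + (2 * u + A) ≡ 2 * (2 * A) + 2 * u
  expandA = solve-∀
  expandU : (A u : ℕ) → 3 * u + (2 * A + u) ≡ 2 * A + 2 * (2 * u)
  expandU = solve-∀
  forA : 3 * A + (2 * u + A) ≡ (2 * s + t) + (2 * u + A)
  forA = trans (expandA A u) (sym (trans (regroupA s t u A) (cong₂ (λ x y → 2 * x + y) s+u t+A)))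
  forU : 3 * u + (2 * A + u) ≡ (s + 2 * t) + (2 * A + u)
  forU = trans (expandU A u) (sym (trans (regroupU s t u A) (cong₂ (λ x y → x + 2 * y) s+u t+A)))

-- Multiplied by 9 and written in s, t
-- they become polynomial identities with a nonnegative remainder.
balanced₁ : {A u : ℕ} → u ≤ 2 * A → A ≤ 2 * u → 2 * (A + u) ≤ 5 ·√ (A * u)
balanced₁ {A} {u} u≤2A A≤2u with thirds u≤2A A≤2u
... | s , t , 3A≡ , 3u≡ = squared (*-cancelˡ-≤ 9 (begin
  9 * (2 * (A + u) * (2 * (A + u)))         ≡⟨ scaleL A u ⟩
  4 * ((3 * A + 3 * u) * (3 * A + 3 * u))   ≡⟨ cong₂ (λ x y → 4 * ((x + y) * (x + y))) 3A≡ 3u≡ ⟩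
  L s t                                     ≤⟨ m≤m+n (L s t) _ ⟩
  L s t + (14 * s * s + 53 * s * t + 14 * t * t) ≡⟨ certificate s t ⟩
  25 * ((2 * s + t) * (s + 2 * t))          ≡⟨ cong₂ (λ x y → 25 * (x * y)) 3A≡ 3u≡ ⟨
  25 * (3 * A * (3 * u))                    ≡⟨ scaleR A u ⟩
  9 * (5 * 5 * (A * u))                     ∎))
  where
  open ≤-Reasoning
  L : ℕ → ℕ → ℕ
  L s t = 4 * ((2 * s + t + (s + 2 * t)) * (2 * s + t + (s + 2 * t)))
  scaleL : (A u : ℕ) → 9 * (2 * (A + u) * (2 * (A + u))) ≡ 4 * ((3 * A + 3 * u) * (3 * A + 3 * u))
  scaleL = solve-∀
  certificate : (s t : ℕ) → 4 * ((2 * s + t + (s + 2 * t)) * (2 * s + t + (s + 2 * t)))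
                              + (14 * s * s + 53 * s * t + 14 * t * t)
                            ≡ 25 * ((2 * s + t) * (s + 2 * t))
  certificate = solve-∀
  scaleR : (A u : ℕ) → 25 * (3 * A * (3 * u)) ≡ 9 * (5 * 5 * (A * u))
  scaleR = solve-∀

balanced₂ : {A u : ℕ} → u ≤ 2 * A → A ≤ 2 * u → 2 * 2 * (A + 2 * u) ≤ 3 * 5 ·√ (A * u)
balanced₂ {A} {u} u≤2A A≤2u with thirds u≤2A A≤2u
... | s , t , 3A≡ , 3u≡ = squared (*-cancelˡ-≤ 9 (begin
  9 * (2 * 2 * (A + 2 * u) * (2 * 2 * (A + 2 * u)))   ≡⟨ scaleL A u ⟩
  16 * ((3 * A + 2 * (3 * u)) * (3 * A + 2 * (3 * u))) ≡⟨ cong₂ (λ x y → 16 * ((x + 2 * y) * (x + 2 * y))) 3A≡ 3u≡ ⟩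
  L s t                                               ≤⟨ m≤m+n (L s t) _ ⟩
  L s t + (194 * s * s + 485 * s * t + 50 * t * t)    ≡⟨ certificate s t ⟩
  225 * ((2 * s + t) * (s + 2 * t))                   ≡⟨ cong₂ (λ x y → 225 * (x * y)) 3A≡ 3u≡ ⟨
  225 * (3 * A * (3 * u))                             ≡⟨ scaleR A u ⟩
  9 * (3 * 5 * (3 * 5) * (A * u))                     ∎))
  where
  open ≤-Reasoning
  L : ℕ → ℕ → ℕ
  L s t = 16 * ((2 * s + t + 2 * (s + 2 * t)) * (2 * s + t + 2 * (s + 2 * t)))
  scaleL : (A u : ℕ) → 9 * (2 * 2 * (A + 2 * u) * (2 * 2 * (A + 2 * u))) ≡ 16 * ((3 * A + 2 * (3 * u)) * (3 * A + 2 * (3 * u)))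
  scaleL = solve-∀
  certificate : (s t : ℕ) → 16 * ((2 * s + t + 2 * (s + 2 * t)) * (2 * s + t + 2 * (s + 2 * t)))
                              + (194 * s * s + 485 * s * t + 50 * t * t)
                            ≡ 225 * ((2 * s + t) * (s + 2 * t))
  certificate = solve-∀
  scaleR : (A u : ℕ) → 225 * (3 * A * (3 * u)) ≡ 9 * (3 * 5 * (3 * 5) * (A * u))
  scaleR = solve-∀

-- A split with 2^k and m·2^r within a factor 2 meets the bound 2.5(1 + 1/2m)√(m·2^n).
balancedSplitBound : (m' A R : ℕ) → suc m' * R ≤ 2 * A → A ≤ 2 * (suc m' * R) →
  (A + R + suc m' * R) * (2 * (2 * suc m')) ≤ 5 * (2 * suc m' + 1) ·√ (suc m' * (A * R))
balancedSplitBound m' A R u≤2A A≤2u = splitBound 5 1 m' A R (balanced₁ u≤2A A≤2u) (balanced₂ u≤2A A≤2u)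

-- The unnormalised rational A / B (for B ≥ 1); products, sums and comparisons
-- of such fractions reduce to natural-number arithmetic.
frac : ℕ → ℕ → ℚᵘ
frac A B = mkℚᵘ (+ A) (B ∸ 1)

toℚᵘ-frac : (A b : ℕ) → toℚᵘ (+ A / suc b) ≃ frac A (suc b)
toℚᵘ-frac A b = ℚₚ.toℚᵘ-fromℚᵘ (mkℚᵘ (+ A) b)

frac-* : (A b A' b' : ℕ) → frac A (suc b) ℚᵘ.* frac A' (suc b') ≃ frac (A * A') (suc b * suc b')
frac-* A b A' b' = *≡* (cong (ℤ._* + (suc b * suc b')) (sym (ℤₚ.pos-* A A')))

frac-+ : (A b A' b' : ℕ) →
  frac A (suc b) ℚᵘ.+ frac A' (suc b') ≃ frac (A * suc b' + A' * suc b) (suc b * suc b')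
frac-+ A b A' b' = *≡* (cong (ℤ._* + (suc b * suc b')) (sym (begin
  + (A * suc b' + A' * suc b)            ≡⟨ ℤₚ.pos-+ (A * suc b') (A' * suc b) ⟩
  + (A * suc b') ℤ.+ + (A' * suc b)      ≡⟨ cong₂ ℤ._+_ (ℤₚ.pos-* A (suc b')) (ℤₚ.pos-* A' (suc b)) ⟩
  + A ℤ.* + suc b' ℤ.+ + A' ℤ.* + suc b  ∎)))
  where open ≡-Reasoning

frac-≤ : (A b A' b' : ℕ) → A * suc b' ≤ A' * suc b → frac A (suc b) ℚᵘ.≤ frac A' (suc b')
frac-≤ A b A' b' le = *≤* (subst₂ ℤ._≤_ (ℤₚ.pos-* A (suc b')) (ℤₚ.pos-* A' (suc b)) (ℤ.+≤+ le))

frac-< : (A b A' b' : ℕ) → A * suc b' < A' * suc b → frac A (suc b) ℚᵘ.< frac A' (suc b')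
frac-< A b A' b' lt = *<* (subst₂ ℤ._<_ (ℤₚ.pos-* A (suc b')) (ℤₚ.pos-* A' (suc b)) (ℤ.+<+ lt))

ε : ℕ → ℚ
ε zero          = 0ℚ
ε m@(suc _)     = + 1 / (2 * m)

ε-nonneg : (m : ℕ) → 0ℚ ℚ.≤ ε m
ε-nonneg zero    = ℚₚ.≤-refl
ε-nonneg (suc k) = ℚₚ.toℚᵘ-cancel-≤
  (ℚᵘₚ.≤-respʳ-≃ (ℚᵘₚ.≃-sym (toℚᵘ-frac 1 (2 * suc k ∸ 1))) (frac-≤ 0 0 1 (2 * suc k ∸ 1) z≤n))

ε-tendsToZero : TendsToZero ε
ε-tendsToZero (mkℚ (+ zero) d _)    (ℚ.*<* (ℤ.+<+ ()))
ε-tendsToZero (mkℚ ℤ.-[1+ a ] d _)  (ℚ.*<* ())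
ε-tendsToZero δ@(mkℚ (+ suc a) d _) _ = suc d , small
  where
  small : ∀ m → suc d ≤ m → ∣ ε m ∣ ℚ.< δ
  small (suc k) (s≤s d≤k) rewrite ℚₚ.0≤p⇒∣p∣≡p (ε-nonneg (suc k)) =
    ℚₚ.toℚᵘ-cancel-< (ℚᵘₚ.<-respˡ-≃ (ℚᵘₚ.≃-sym (toℚᵘ-frac 1 (2 * suc k ∸ 1))) (frac-< 1 (2 * suc k ∸ 1) (suc a) d cross))
    where
    cross : 1 * suc d < suc a * (2 * suc k)
    cross = begin-strict
      1 * suc d          ≡⟨ *-identityˡ (suc d) ⟩
      suc d              ≤⟨ s≤s d≤k ⟩
      suc k              <⟨ m<m+n (suc k) (s≤s z≤n) ⟩
      2 * suc k          ≤⟨ m≤n*m (2 * suc k) (suc a) ⟩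
      suc a * (2 * suc k) ∎
      where open ≤-Reasoning

fromFraction : (a : ℚ) (N b c X : ℕ) → toℚᵘ a ≃ frac N (suc b) → c * suc b ≤ N ·√ X → LeTimesSqrt c a X
fromFraction a N b c X a≃ (squared bound) = nonneg , squares
  where
  B = suc b
  nonneg : 0ℚ ℚ.≤ a
  nonneg = ℚₚ.toℚᵘ-cancel-≤ (ℚᵘₚ.≤-respʳ-≃ (ℚᵘₚ.≃-sym a≃) (frac-≤ 0 0 N b z≤n))
  a²≃ : toℚᵘ (a *ℚ a) ≃ frac (N * N) (B * B)
  a²≃ = ℚᵘₚ.≃-trans (ℚₚ.toℚᵘ-homo-* a a) (ℚᵘₚ.≃-trans (ℚᵘₚ.*-cong a≃ a≃) (frac-* N b N b))
  a²X≃ : toℚᵘ (a *ℚ a *ℚ ℕtoℚ X) ≃ frac (N * N * X) (B * B * 1)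
  a²X≃ = ℚᵘₚ.≃-trans (ℚₚ.toℚᵘ-homo-* (a *ℚ a) (ℕtoℚ X))
           (ℚᵘₚ.≃-trans (ℚᵘₚ.*-cong a²≃ (toℚᵘ-frac X 0)) (frac-* (N * N) (B * B ∸ 1) X 0))
  rearrange : (c B : ℕ) → c * B * (c * B) ≡ c * c * (B * B * 1)
  rearrange = solve-∀
  cross : c * c * (B * B * 1) ≤ N * N * X * 1
  cross = subst₂ _≤_ (rearrange c B) (sym (*-identityʳ _)) bound
  squares : ℕtoℚ (c * c) ℚ.≤ a *ℚ a *ℚ ℕtoℚ X
  squares = ℚₚ.toℚᵘ-cancel-≤ (ℚᵘₚ.≤-respʳ-≃ (ℚᵘₚ.≃-sym a²X≃)
    (ℚᵘₚ.≤-respˡ-≃ (ℚᵘₚ.≃-sym (toℚᵘ-frac (c * c) 0)) (frac-≤ (c * c) 0 (N * N * X) (B * B * 1 ∸ 1) cross)))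

coefficient≃ : (p q k : ℕ) → let m = suc k in
  toℚᵘ ((+ p / suc q) *ℚ (1ℚ +ℚ ε m)) ≃ frac (p * (1 * (2 * m) + 1 * 1)) (suc q * (1 * (2 * m)))
coefficient≃ p q k = ℚᵘₚ.≃-trans (ℚₚ.toℚᵘ-homo-* (+ p / suc q) (1ℚ +ℚ ε m))
  (ℚᵘₚ.≃-trans (ℚᵘₚ.*-cong (toℚᵘ-frac p q) one+ε≃) (frac-* p q _ (1 * (2 * m) ∸ 1)))
  where
  m = suc k
  one+ε≃ : toℚᵘ (1ℚ +ℚ ε m) ≃ frac (1 * (2 * m) + 1 * 1) (1 * (2 * m))
  one+ε≃ = ℚᵘₚ.≃-trans (ℚₚ.toℚᵘ-homo-+ 1ℚ (ε m))
    (ℚᵘₚ.≃-trans (ℚᵘₚ.+-cong (toℚᵘ-frac 1 0) (toℚᵘ-frac 1 (2 * m ∸ 1))) (frac-+ 1 0 1 (2 * m ∸ 1)))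

fromNaturalBound : (p q k c X : ℕ) → let m = suc k in
  c * (suc q * (2 * m)) ≤ p * (2 * m + 1) ·√ X →
  LeTimesSqrt c ((+ p / suc q) *ℚ (1ℚ +ℚ ε m)) X
fromNaturalBound p q k c X bound =
  fromFraction _ _ _ c X (coefficient≃ p q k) (·√-resp denominator≡ numerator≡ refl bound)
  where
  m = suc k
  denominator≡ : c * (suc q * (2 * m)) ≡ c * (suc q * (1 * (2 * m)))
  denominator≡ = cong (λ x → c * (suc q * x)) (sym (*-identityˡ (2 * m)))
  numerator≡ : p * (2 * m + 1) ≡ p * (1 * (2 * m) + 1 * 1)
  numerator≡ = cong (p *_) (sym (cong₂ _+_ (*-identityˡ (2 * m)) (*-identityˡ 1)))

exactSplit : (n t j : ℕ) → n + t ≡ 2 * j → t ≤ n → (j + (n ∸ j) ≡ n) × (2 ^ t * 2 ^ (n ∸ j) ≡ 2 ^ j)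
exactSplit n t j n+t≡2j t≤n = j+r≡n , (begin
  2 ^ t * 2 ^ (n ∸ j)   ≡⟨ ^-distribˡ-+-* 2 t (n ∸ j) ⟨
  2 ^ (t + (n ∸ j))     ≡⟨ cong (2 ^_) t+r≡j ⟩
  2 ^ j                 ∎)
  where
  open ≡-Reasoning
  twice : (x : ℕ) → x + x ≡ 2 * x
  twice = solve-∀
  j≤n : j ≤ n
  j≤n = *-cancelˡ-≤ 2 (subst₂ _≤_ n+t≡2j (twice n) (+-monoʳ-≤ n t≤n))
  j+r≡n : j + (n ∸ j) ≡ n
  j+r≡n = m+[n∸m]≡n j≤n
  regroup : (j t r : ℕ) → j + (t + r) ≡ (j + r) + t
  regroup = solve-∀
  t+r≡j : t + (n ∸ j) ≡ j
  t+r≡j = +-cancelˡ-≡ j _ _ (begin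
    j + (t + (n ∸ j))   ≡⟨ regroup j t (n ∸ j) ⟩
    j + (n ∸ j) + t     ≡⟨ cong (_+ t) j+r≡n ⟩
    n + t               ≡⟨ n+t≡2j ⟩
    2 * j               ≡⟨ twice j ⟨
    j + j               ∎)

-- Choice of the split in general: if 1 ≤ m ≤ 2·2^n, some n = k + r puts 2^k
-- and m·2^r within a factor 2.  Starting from k = 0, r = n, move one unit of
-- exponent from r to k while m·2^r > 2·2^k; the invariant 2^k ≤ 2·m·2^r is kept.
balancedSplit : (m n : ℕ) → 1 ≤ m → m ≤ 2 * 2 ^ n →
  Σ ℕ λ k → Σ ℕ λ r → (k + r ≡ n) × (2 ^ k ≤ 2 * (m * 2 ^ r)) × (m * 2 ^ r ≤ 2 * 2 ^ k)
balancedSplit m n 1≤m m≤2·2ⁿ = search n 0 start m≤2·2ⁿ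
  where
  start : 1 ≤ 2 * (m * 2 ^ n)
  start = ≤-trans (≤-trans 1≤m (m≤m*n m (2 ^ n) {{m^n≢0 2 n}})) (m≤n*m (m * 2 ^ n) 2)
  shift : (m x : ℕ) → m * (2 * x) ≡ 2 * (m * x)
  shift = solve-∀
  search : (r k : ℕ) → 2 ^ k ≤ 2 * (m * 2 ^ r) → m ≤ 2 * 2 ^ (k + r) →
    Σ ℕ λ k' → Σ ℕ λ r' → (k' + r' ≡ k + r) × (2 ^ k' ≤ 2 * (m * 2 ^ r')) × (m * 2 ^ r' ≤ 2 * 2 ^ k')
  search r k lower m≤ with m * 2 ^ r ≤? 2 * 2 ^ k
  ... | yes upper = k , r , refl , lower , upper
  search zero k lower m≤ | no ¬upper =
    contradiction (subst₂ _≤_ (sym (*-identityʳ m)) (cong (λ e → 2 * 2 ^ e) (+-identityʳ k)) m≤) ¬upper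
  search (suc r) k lower m≤ | no ¬upper
    with search r (suc k) (subst (2 ^ suc k ≤_) (shift m (2 ^ r)) (<⇒≤ (≰⇒> ¬upper)))
                          (subst (λ e → m ≤ 2 * 2 ^ e) (+-suc k r) m≤)
  ... | k' , r' , k'+r'≡ , lower' , upper' = k' , r' , trans k'+r'≡ (sym (+-suc k r)) , lower' , upper'

-- CostBound f p q : some circuit for f has c AND gates with
-- c·(q+1)·2m ≤ p(2m+1) √(m·2^n), i.e. c ≤ (p/(q+1))(1 + 1/2m) √(m·2^n).
CostBound : {m : ℕ} → (Vec Bool n → Vec Bool m) → ℕ → ℕ → Set
CostBound {n} {m} f p q = Σ ℕ λ c → MCAtMost f c × c * (suc q * (2 * m)) ≤ p * (2 * m + 1) ·√ (m * 2 ^ n)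

goodBound : (n m' : ℕ) (f : Vec Bool n → Vec Bool (suc m')) → Good n (suc m') → CostBound f 2 0
goodBound n m' f (t , m≡2ᵗ , j , n+t≡2j) with t ≤? n
... | yes t≤n = _ , splitConstruction j r j+r≡n f ,
                ·√-resp refl refl (cong (suc m' *_) 2ʲ·2ʳ≡2ⁿ) (exactSplitBound m' (2 ^ j) (2 ^ r) m·2ʳ≡2ʲ)
  where
  r = n ∸ j
  j+r≡n : j + r ≡ n
  j+r≡n = proj₁ (exactSplit n t j n+t≡2j t≤n)
  m·2ʳ≡2ʲ : suc m' * 2 ^ r ≡ 2 ^ j
  m·2ʳ≡2ʲ = trans (cong (_* 2 ^ r) m≡2ᵗ) (proj₂ (exactSplit n t j n+t≡2j t≤n))
  2ʲ·2ʳ≡2ⁿ : 2 ^ j * 2 ^ r ≡ 2 ^ n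
  2ʲ·2ʳ≡2ⁿ = trans (sym (^-distribˡ-+-* 2 j r)) (cong (2 ^_) j+r≡n)
... | no t≰n = 2 ^ n , fullConstruction f , fullBound 2 0 (suc m') (2 ^ n) 1 2ⁿ≤m (m≤m+n 1 3)
  where
  2ⁿ≤m : 2 ^ n ≤ 1 * suc m'
  2ⁿ≤m = subst (2 ^ n ≤_) (trans (sym m≡2ᵗ) (sym (*-identityˡ _))) (^-monoʳ-≤ 2 (<⇒≤ (≰⇒> t≰n)))

-- Every m: c∧(f) ≤ 2.5(1 + 1/2m) √(m·2^n).  If 2^n ≤ 4m the full construction
-- suffices; otherwise a balanced split does.
anyBound : (n m' : ℕ) (f : Vec Bool n → Vec Bool (suc m')) → CostBound f 5 1
anyBound n m' f with 2 ^ n ≤? 4 * suc m'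
... | yes 2ⁿ≤4m = 2 ^ n , fullConstruction f , fullBound 5 1 (suc m') (2 ^ n) 4 2ⁿ≤4m (m≤m+n 16 9)
... | no 2ⁿ≰4m = balanced (balancedSplit (suc m') n (s≤s z≤n) m≤2·2ⁿ)
  where
  m≤2·2ⁿ : suc m' ≤ 2 * 2 ^ n
  m≤2·2ⁿ = ≤-trans (m≤n*m (suc m') 4) (≤-trans (<⇒≤ (≰⇒> 2ⁿ≰4m)) (m≤n*m (2 ^ n) 2))
  balanced : (Σ ℕ λ k → Σ ℕ λ r → (k + r ≡ n) × (2 ^ k ≤ 2 * (suc m' * 2 ^ r)) × (suc m' * 2 ^ r ≤ 2 * 2 ^ k)) →
    CostBound f 5 1
  balanced (k , r , k+r≡n , lower , upper) =
    _ , splitConstruction k r k+r≡n f ,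
    ·√-resp refl refl (cong (suc m' *_) 2ᵏ·2ʳ≡2ⁿ) (balancedSplitBound m' (2 ^ k) (2 ^ r) upper lower)
    where
    2ᵏ·2ʳ≡2ⁿ : 2 ^ k * 2 ^ r ≡ 2 ^ n
    2ᵏ·2ʳ≡2ⁿ = trans (sym (^-distribˡ-+-* 2 k r)) (cong (2 ^_) k+r≡n)

withCoefficient : (p q m' : ℕ) {f : Vec Bool n → Vec Bool (suc m')} → CostBound f p q →
  Σ ℕ λ c → MCAtMost f c × LeTimesSqrt c ((+ p / suc q) *ℚ (1ℚ +ℚ ε (suc m'))) (suc m' * 2 ^ n)
withCoefficient p q m' (c , circuit , bound) = c , circuit , fromNaturalBound p q m' c _ bound

mainTheorem9 : Σ (ℕ → ℚ) λ ε → TendsToZero ε ×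
    (∀ (n m : ℕ) → 1 ≤ n → 1 ≤ m → (f : Vec Bool n → Vec Bool m) →
      (Good n m → Σ ℕ λ c → MCAtMost f c × LeTimesSqrt c ((+ 2 / 1) *ℚ (1ℚ +ℚ ε m)) (m * 2 ^ n)) ×
      (¬ Good n m → Σ ℕ λ c → MCAtMost f c × LeTimesSqrt c ((+ 5 / 2) *ℚ (1ℚ +ℚ ε m)) (m * 2 ^ n)))
mainTheorem9 = ε , ε-tendsToZero , bounds
  where
  bounds : ∀ (n m : ℕ) → 1 ≤ n → 1 ≤ m → (f : Vec Bool n → Vec Bool m) →
    (Good n m → Σ ℕ λ c → MCAtMost f c × LeTimesSqrt c ((+ 2 / 1) *ℚ (1ℚ +ℚ ε m)) (m * 2 ^ n)) ×
    (¬ Good n m → Σ ℕ λ c → MCAtMost f c × LeTimesSqrt c ((+ 5 / 2) *ℚ (1ℚ +ℚ ε m)) (m * 2 ^ n))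
  bounds n (suc m') _ _ f =
    (λ good → withCoefficient 2 0 m' (goodBound n m' f good)) ,
    (λ _ → withCoefficient 5 1 m' (anyBound n m' f))
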